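{- For every $\mathsf{sSKSg}$ proof of size $n$ there exists a proof of the same formula in $\mathsf{sFrege}$ whose length and size are respectively $O(n^4)$ and $O(n^5)$.
   Context: CoS: formulae built from units $\mathsf f,\mathsf t$, atoms $a,\bar a,\dots$, formula variables $A,\bar A,\dots$ by $[\alpha\vee\beta]$ and $(\alpha\wedge\beta)$; $\bar\cdot$ involution on atoms and on variables with $\bar a\ne a$, $\bar A\ne A$; the De Morgan dual $\bar\alpha$ exchanges $\vee/\wedge$, $\mathsf t/\mathsf f$ and negates atoms and variables. Equality $=$ is the smallest context-closed equivalence containing commutativity and associativity of $\vee,\wedge$, $[\alpha\vee\mathsf f]=\alpha$, $(\alpha\wedge\mathsf t)=\alpha$, $[\mathsf t\vee\mathsf t]=\mathsf t$, $(\mathsf f\wedge\mathsf f)=\mathsf f$. A substitution $\sigma$ maps variables to formulae (applied simultaneously, $\bar A\mapsto$ dual of $\sigma(A)$); a renaming maps atoms to atoms. A rule $\alpha/\beta$ has instances $\alpha\rho\sigma/\beta\rho\sigma$ and generates steps $\xi\{\gamma\}/\xi\{\delta\}$ for any context (formula with one hole) $\xi$. A derivation in $\mathcal S$ is a chain of formulae alternating $=$-steps and steps generated by rules of $\mathcal S$; its size is the number of occurrences of units, atoms and variables; a proof has premiss $\mathsf t$. $\mathsf{SKSg}$ has the rules $\mathsf t/[A\vee\bar A]$, $(A\wedge\bar A)/\mathsf f$, $\mathsf f/A$, $A/\mathsf t$, $[A\vee A]/A$, $A/(A\wedge A)$, $(A\wedge[B\vee C])/[(A\wedge B)\vee C]$.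 $\mathsf{sSKSg}$: a proof of $\mathsf{SKSg}$ in which, in addition, one may use steps of the substitution rule from a whole formula $\gamma$ (not inside a context) to $\gamma\sigma$. $\mathsf{Frege}$: formulae over $\mathsf t,\mathsf f$, non-negated variables, $\vee,\wedge,\to,\neg$; axiom schemes $F_1: A\to(B\to(A\wedge B))$; $F_2:(A\wedge B)\to A$; $F_3:(A\wedge B)\to B$; $F_4:A\to(A\vee B)$; $F_5:B\to(A\vee B)$; $F_6:\neg\neg A\to A$; $F_7:A\to\neg\neg A$; $F_8:A\to(B\to A)$; $F_9:\neg A\to(A\to B)$; $F_{10}:(A\to(B\to C))\to((A\to B)\to(A\to C))$; $F_{11}:(A\to C)\to((B\to C)\to((A\vee B)\to C))$; $F_{12}:(A\to(B\to C))\to(B\to(A\to C))$; $F_{13}:(A\to B)\to(\neg B\to\neg A)$; $F_{14}:\mathsf f\to(A\wedge\neg A)$; $F_{15}:(A\wedge\neg A)\to\mathsf f$; $F_{16}:\mathsf t\to(A\vee\neg A)$; $F_{17}:(A\vee\neg A)\to\mathsf t$ (instances by substituting formulae), and modus ponens. $\mathsf{sFrege}$: a proof is a sequence of formulae each of which is an axiom instance, follows by modus ponens from earlier formulae, or is $\alpha_j\sigma$ for an earlier formula $\alpha_j$ and a substitution $\sigma$; the last formula is its conclusion; length = number of formulae, size = number of occurrences of units and variables. Translation between languages: atoms and variables correspond to Frege variables, negated atoms/variables to $\neg$ of variables, $\neg\alpha$ to the dual, $\alpha\to\beta$ to $[\bar\alpha\vee\beta]$. -}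

module Defs where

open import Data.Nat using (ℕ; zero; suc; _+_; _*_; _^_; _≤_)
open import Data.Bool using (Bool; true; false; not)
open import Data.Sum using (_⊎_; inj₁; inj₂)
open import Data.Product using (Σ; _×_; _,_; ∃)
open import Data.List using (List; []; _∷_; length)
open import Data.List.Membership.Propositional using (_∈_)
open import Relation.Binary.PropositionalEquality using (_≡_)

-- Atoms and formula variables are names (ℕ) together with a polarity:
-- polarity true = a (resp. A), polarity false = ā (resp. Ā).
-- The involution flips the polarity, so ā ≠ a and Ā ≠ A.

data Fm : Set where
  𝕗 𝕥  : Fm
  atom : Bool → ℕ → Fm
  var  : Bool → ℕ → Fm
  _∨_  : Fm → Fm → Fm
  _∧_  : Fm → Fm → Fm

infixr 5 _∨_
infixr 6 _∧_

dual : Fm → Fm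
dual 𝕗 = 𝕥
dual 𝕥 = 𝕗
dual (atom b a) = atom (not b) a
dual (var b A) = var (not b) A
dual (α ∨ β) = dual α ∧ dual β
dual (α ∧ β) = dual α ∨ dual β

data _≈_ : Fm → Fm → Set where
  ≈-refl  : ∀ {α} → α ≈ α
  ≈-sym   : ∀ {α β} → α ≈ β → β ≈ α
  ≈-trans : ∀ {α β γ} → α ≈ β → β ≈ γ → α ≈ γ
  ∨-cong  : ∀ {α α' β β'} → α ≈ α' → β ≈ β' → (α ∨ β) ≈ (α' ∨ β')
  ∧-cong  : ∀ {α α' β β'} → α ≈ α' → β ≈ β' → (α ∧ β) ≈ (α' ∧ β')
  ∨-comm  : ∀ {α β} → (α ∨ β) ≈ (β ∨ α)
  ∧-comm  : ∀ {α β} → (α ∧ β) ≈ (β ∧ α)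
  ∨-assoc : ∀ {α β γ} → ((α ∨ β) ∨ γ) ≈ (α ∨ (β ∨ γ))
  ∧-assoc : ∀ {α β γ} → ((α ∧ β) ∧ γ) ≈ (α ∧ (β ∧ γ))
  ∨-unit  : ∀ {α} → (α ∨ 𝕗) ≈ α
  ∧-unit  : ∀ {α} → (α ∧ 𝕥) ≈ α
  𝕥∨𝕥     : (𝕥 ∨ 𝕥) ≈ 𝕥
  𝕗∧𝕗     : (𝕗 ∧ 𝕗) ≈ 𝕗

Subst : Set
Subst = ℕ → Fm

_[_] : Fm → Subst → Fm
𝕗 [ σ ] = 𝕗
𝕥 [ σ ] = 𝕥
atom b a [ σ ] = atom b a
var true A [ σ ] = σ A
var false A [ σ ] = dual (σ A)
(α ∨ β) [ σ ] = (α [ σ ]) ∨ (β [ σ ])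
(α ∧ β) [ σ ] = (α [ σ ]) ∧ (β [ σ ])

-- Renamings map atoms to atoms, commuting with the involution:
-- a positive atom name is sent to an atom (with polarity), ā to its bar.
Renaming : Set
Renaming = ℕ → Bool × ℕ

pol : Bool → Bool → Bool
pol true b = b
pol false b = not b

rename : Fm → Renaming → Fm
rename 𝕗 ρ = 𝕗
rename 𝕥 ρ = 𝕥
rename (atom b a) ρ with ρ a
... | c , a' = atom (pol b c) a'
rename (var b A) ρ = var b A
rename (α ∨ β) ρ = rename α ρ ∨ rename β ρ
rename (α ∧ β) ρ = rename α ρ ∧ rename β ρ

data Ctx : Set where
  □    : Ctx
  _∨ₗ_ : Ctx → Fm → Ctx
  _∨ᵣ_ : Fm → Ctx → Ctx
  _∧ₗ_ : Ctx → Fm → Ctx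
  _∧ᵣ_ : Fm → Ctx → Ctx

_⟪_⟫ : Ctx → Fm → Fm
□ ⟪ γ ⟫ = γ
(ξ ∨ₗ β) ⟪ γ ⟫ = (ξ ⟪ γ ⟫) ∨ β
(α ∨ᵣ ξ) ⟪ γ ⟫ = α ∨ (ξ ⟪ γ ⟫)
(ξ ∧ₗ β) ⟪ γ ⟫ = (ξ ⟪ γ ⟫) ∧ β
(α ∧ᵣ ξ) ⟪ γ ⟫ = α ∧ (ξ ⟪ γ ⟫)

vA vB vC v̄A : Fm
vA = var true 0
vB = var true 1
vC = var true 2
v̄A = var false 0

data SKSgRule : Fm → Fm → Set where
  ai↓ : SKSgRule 𝕥 (vA ∨ v̄A)
  ai↑ : SKSgRule (vA ∧ v̄A) 𝕗
  aw↓ : SKSgRule 𝕗 vA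
  aw↑ : SKSgRule vA 𝕥
  ac↓ : SKSgRule (vA ∨ vA) vA
  ac↑ : SKSgRule vA (vA ∧ vA)
  s   : SKSgRule (vA ∧ (vB ∨ vC)) ((vA ∧ vB) ∨ vC)

data SKSgStep : Fm → Fm → Set where
  step : ∀ {α β} → SKSgRule α β → (ρ : Renaming) (σ : Subst) (ξ : Ctx) →
         SKSgStep (ξ ⟪ rename α ρ [ σ ] ⟫) (ξ ⟪ rename β ρ [ σ ] ⟫)

-- Steps allowed in sSKSg: SKSg steps, or the substitution rule applied
-- to a whole formula (not inside a context).
data sSKSgStep : Fm → Fm → Set where
  sks : ∀ {α β} → SKSgStep α β → sSKSgStep α β
  sub : ∀ {γ} (σ : Subst) → sSKSgStep γ (γ [ σ ])

size : Fm → ℕ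
size 𝕗 = 1
size 𝕥 = 1
size (atom _ _) = 1
size (var _ _) = 1
size (α ∨ β) = size α + size β
size (α ∧ β) = size α + size β

-- Derivations: chains of formulae alternating =-steps and rule steps.
-- ChainE: next step (if any) is an =-step; ChainR: next step (if any)
-- is a rule step.
module _ (R : Fm → Fm → Set) where
  mutual
    data ChainE : Fm → Fm → Set where
      stopE : ∀ α → ChainE α α
      eqE   : ∀ {α β γ} → α ≈ β → ChainR β γ → ChainE α γ

    data ChainR : Fm → Fm → Set where
      stopR : ∀ α → ChainR α α
      rlR   : ∀ {α β γ} → R α β → ChainE β γ → ChainR α γ

  Derivation : Fm → Fm → Set
  Derivation α β = ChainE α β ⊎ ChainR α β

  mutual
    sizeE : ∀ {α β} → ChainE α β → ℕ
    sizeE (stopE α) = size α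
    sizeE (eqE {α} _ d) = size α + sizeR d

    sizeR : ∀ {α β} → ChainR α β → ℕ
    sizeR (stopR α) = size α
    sizeR (rlR {α} _ d) = size α + sizeE d

  derivationSize : ∀ {α β} → Derivation α β → ℕ
  derivationSize (inj₁ d) = sizeE d
  derivationSize (inj₂ d) = sizeR d

sSKSgProof : Fm → Set
sSKSgProof φ = Derivation sSKSgStep 𝕥 φ

sSKSgSize : ∀ {φ} → sSKSgProof φ → ℕ
sSKSgSize = derivationSize sSKSgStep

-- Frege variables: one for each CoS atom name (inj₁) and one for each
-- CoS formula-variable name (inj₂).

FVar : Set
FVar = ℕ ⊎ ℕ

data FFm : Set where
  ⊤ᶠ ⊥ᶠ : FFm
  fv    : FVar → FFm
  _∨ᶠ_ _∧ᶠ_ _⇒_ : FFm → FFm → FFm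
  ¬ᶠ_   : FFm → FFm

infixr 4 _⇒_
infixr 5 _∨ᶠ_
infixr 6 _∧ᶠ_
infix 7 ¬ᶠ_

data Axiom : FFm → Set where
  F1  : ∀ A B → Axiom (A ⇒ (B ⇒ (A ∧ᶠ B)))
  F2  : ∀ A B → Axiom ((A ∧ᶠ B) ⇒ A)
  F3  : ∀ A B → Axiom ((A ∧ᶠ B) ⇒ B)
  F4  : ∀ A B → Axiom (A ⇒ (A ∨ᶠ B))
  F5  : ∀ A B → Axiom (B ⇒ (A ∨ᶠ B))
  F6  : ∀ A → Axiom ((¬ᶠ ¬ᶠ A) ⇒ A)
  F7  : ∀ A → Axiom (A ⇒ (¬ᶠ ¬ᶠ A))
  F8  : ∀ A B → Axiom (A ⇒ (B ⇒ A))
  F9  : ∀ A B → Axiom ((¬ᶠ A) ⇒ (A ⇒ B))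
  F10 : ∀ A B C → Axiom ((A ⇒ (B ⇒ C)) ⇒ ((A ⇒ B) ⇒ (A ⇒ C)))
  F11 : ∀ A B C → Axiom ((A ⇒ C) ⇒ ((B ⇒ C) ⇒ ((A ∨ᶠ B) ⇒ C)))
  F12 : ∀ A B C → Axiom ((A ⇒ (B ⇒ C)) ⇒ (B ⇒ (A ⇒ C)))
  F13 : ∀ A B → Axiom ((A ⇒ B) ⇒ ((¬ᶠ B) ⇒ (¬ᶠ A)))
  F14 : ∀ A → Axiom (⊥ᶠ ⇒ (A ∧ᶠ (¬ᶠ A)))
  F15 : ∀ A → Axiom ((A ∧ᶠ (¬ᶠ A)) ⇒ ⊥ᶠ)
  F16 : ∀ A → Axiom (⊤ᶠ ⇒ (A ∨ᶠ (¬ᶠ A)))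
  F17 : ∀ A → Axiom ((A ∨ᶠ (¬ᶠ A)) ⇒ ⊤ᶠ)

FSubst : Set
FSubst = FVar → FFm

_[_]ᶠ : FFm → FSubst → FFm
⊤ᶠ [ σ ]ᶠ = ⊤ᶠ
⊥ᶠ [ σ ]ᶠ = ⊥ᶠ
fv x [ σ ]ᶠ = σ x
(α ∨ᶠ β) [ σ ]ᶠ = (α [ σ ]ᶠ) ∨ᶠ (β [ σ ]ᶠ)
(α ∧ᶠ β) [ σ ]ᶠ = (α [ σ ]ᶠ) ∧ᶠ (β [ σ ]ᶠ)
(α ⇒ β) [ σ ]ᶠ = (α [ σ ]ᶠ) ⇒ (β [ σ ]ᶠ)
(¬ᶠ α) [ σ ]ᶠ = ¬ᶠ (α [ σ ]ᶠ)

-- Justification of a line, given the list Γ of EARLIER lines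
data Justified (Γ : List FFm) : FFm → Set where
  ax  : ∀ {φ} → Axiom φ → Justified Γ φ
  mp  : ∀ {α φ} → (α ⇒ φ) ∈ Γ → α ∈ Γ → Justified Γ φ
  sb  : ∀ {α} → α ∈ Γ → (σ : FSubst) → Justified Γ (α [ σ ]ᶠ)

-- An sFrege proof, listed in REVERSE order (head = last line).
data sFregeLines : List FFm → Set where
  []  : sFregeLines []
  _∷_ : ∀ {φ Γ} → Justified Γ φ → sFregeLines Γ → sFregeLines (φ ∷ Γ)

sFregeProof : FFm → Set
sFregeProof φ = Σ (List FFm) (λ Γ → sFregeLines (φ ∷ Γ))

fsize : FFm → ℕ
fsize ⊤ᶠ = 1
fsize ⊥ᶠ = 1
fsize (fv _) = 1
fsize (α ∨ᶠ β) = fsize α + fsize β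
fsize (α ∧ᶠ β) = fsize α + fsize β
fsize (α ⇒ β) = fsize α + fsize β
fsize (¬ᶠ α) = fsize α

linesSize : List FFm → ℕ
linesSize [] = 0
linesSize (φ ∷ Γ) = fsize φ + linesSize Γ

sFregeLength : ∀ {φ} → sFregeProof φ → ℕ
sFregeLength {φ} (Γ , _) = length (φ ∷ Γ)

sFregeSize : ∀ {φ} → sFregeProof φ → ℕ
sFregeSize {φ} (Γ , _) = linesSize (φ ∷ Γ)

tr : Fm → FFm
tr 𝕗 = ⊥ᶠ
tr 𝕥 = ⊤ᶠ
tr (atom true a) = fv (inj₁ a)
tr (atom false a) = ¬ᶠ fv (inj₁ a)
tr (var true A) = fv (inj₂ A)
tr (var false A) = ¬ᶠ fv (inj₂ A)
tr (α ∨ β) = tr α ∨ᶠ tr β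
tr (α ∧ β) = tr α ∧ᶠ tr β

module Submission where

-- An sSKSg proof  𝕥 = α₀ → α₁ → … → αₖ = φ  of size n is translated step by
-- step: starting from a Frege proof of tr 𝕥 = ⊤, each step αᵢ → αᵢ₊₁ is
-- simulated by modus ponens with a proof of tr αᵢ ⇒ tr αᵢ₊₁, built as follows.
--   * Rule steps ξ{γ}/ξ{δ}: a derived scheme proves the rule instance, which is
--     lifted through the context ξ by monotonicity of ∨ and ∧.
--   * Equality steps α = β: the equality derivation may be arbitrarily long, so
--     it is first normalised into a cut-free order calculus α ⊑ β whose
--     derivations are bounded by the formulae themselves.
--   * Substitution steps: a single Frege substitution line, corrected by De
--     Morgan laws because CoS duals of variables become Frege negations.
-- Every implication is assembled from a fixed finite set of derived schemes,
-- each entering the proof through one substitution instance.  Hence every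
-- line has size O(n), and every step costs O(n²) lines; with at most n steps
-- the proof has O(n³) ⊆ O(n⁴) lines and size O(n⁵).

open import Defs
open import Data.Nat using (ℕ; suc; _+_; _*_; _^_; _≤_; _<_; z≤n; s≤s; _≤?_; _<?_; NonZero; >-nonZero)
open import Data.Nat.Properties
open import Data.Nat.Tactic.RingSolver using (solve-∀)
open import Data.Product using (Σ; _×_; _,_; proj₁; proj₂)
open import Data.Sum using (inj₁; inj₂)
open import Data.Bool using (true; false)
open import Data.List using (List; []; _∷_; _++_; length)
open import Data.List.Properties using (length-++)
open import Data.List.Relation.Unary.Any using (here; there)
open import Data.List.Relation.Unary.All using (All; []; _∷_)
open import Data.List.Relation.Unary.All.Properties using (++⁺)
open import Data.List.Membership.Propositional using (_∈_)
open import Data.List.Membership.Propositional.Properties using (∈-++⁺ˡ; ∈-++⁺ʳ)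
open import Relation.Binary.PropositionalEquality using (_≡_; refl; sym; trans; cong; cong₂; subst; module ≡-Reasoning)
open import Relation.Nullary using (Dec)
open import Relation.Nullary.Decidable using (True; toWitness; _×-dec_)

infixl 9 _·_
data _⊢_ (Δ : List FFm) : FFm → Set where
  hyp : ∀ {φ} → φ ∈ Δ → Δ ⊢ φ
  ax  : ∀ {φ} → Axiom φ → Δ ⊢ φ
  _·_ : ∀ {A B} → Δ ⊢ (A ⇒ B) → Δ ⊢ A → Δ ⊢ B

⊢-id : ∀ {Δ} A → Δ ⊢ (A ⇒ A)
⊢-id A = ax (F10 A (A ⇒ A) A) · ax (F8 A (A ⇒ A)) · ax (F8 A A)

ded : ∀ {Δ A B} → (A ∷ Δ) ⊢ B → Δ ⊢ (A ⇒ B)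
ded {A = A} (hyp (here refl)) = ⊢-id A
ded {A = A} (hyp (there i))   = ax (F8 _ A) · hyp i
ded {A = A} (ax a)            = ax (F8 _ A) · ax a
ded {A = A} (_·_ {A = X} {B = Y} p q) = ax (F10 A X Y) · ded p · ded q

⊢-weaken : ∀ {Δ B φ} → Δ ⊢ φ → (B ∷ Δ) ⊢ φ
⊢-weaken (hyp i) = hyp (there i)
⊢-weaken (ax a)  = ax a
⊢-weaken (p · q) = ⊢-weaken p · ⊢-weaken q

h₀ : ∀ {Δ A} → (A ∷ Δ) ⊢ A
h₀ = hyp (here refl)
h₁ : ∀ {Δ A B} → (B ∷ A ∷ Δ) ⊢ A
h₁ = hyp (there (here refl))
h₂ : ∀ {Δ A B C} → (C ∷ B ∷ A ∷ Δ) ⊢ A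
h₂ = hyp (there (there (here refl)))

raa : ∀ {Δ X} → Δ ⊢ ((¬ᶠ X) ⇒ X) → Δ ⊢ X
raa {Δ} {X} h =
  ax (F6 X) · (ax (F13 (¬ᶠ X) (¬ᶠ (X ⇒ X))) · absurd · (ax (F7 (X ⇒ X)) · ⊢-id X))
  where
  absurd : Δ ⊢ ((¬ᶠ X) ⇒ (¬ᶠ (X ⇒ X)))
  absurd = ded (ax (F9 X (¬ᶠ (X ⇒ X))) · h₀ · (⊢-weaken h · h₀))

fA fB fC : FFm
fA = fv (inj₂ 0)
fB = fv (inj₂ 1)
fC = fv (inj₂ 2)

⊢-excluded-middle : [] ⊢ (fA ∨ᶠ ¬ᶠ fA)
⊢-excluded-middle = raa (ded (ax (F9 (¬ᶠ fA) (fA ∨ᶠ ¬ᶠ fA)) · notNotA · notA))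
  where
  notA : ((¬ᶠ (fA ∨ᶠ ¬ᶠ fA)) ∷ []) ⊢ (¬ᶠ fA)
  notA    = ax (F13 fA (fA ∨ᶠ ¬ᶠ fA)) · ax (F4 fA (¬ᶠ fA)) · h₀
  notNotA : ((¬ᶠ (fA ∨ᶠ ¬ᶠ fA)) ∷ []) ⊢ (¬ᶠ ¬ᶠ fA)
  notNotA = ax (F13 (¬ᶠ fA) (fA ∨ᶠ ¬ᶠ fA)) · ax (F5 fA (¬ᶠ fA)) · h₀

⊢-⊤ : [] ⊢ ⊤ᶠ
⊢-⊤ = ax (F17 fA) · ⊢-excluded-middle

data Tree : FFm → Set where
  axiom : ∀ {φ} → Axiom φ → Tree φ
  mp    : ∀ {A B} → Tree (A ⇒ B) → Tree A → Tree B
  inst  : ∀ {φ} → Tree φ → (σ : FSubst) → Tree (φ [ σ ]ᶠ)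

fromHilbert : ∀ {φ} → [] ⊢ φ → Tree φ
fromHilbert (hyp ())
fromHilbert (ax a)  = axiom a
fromHilbert (p · q) = mp (fromHilbert p) (fromHilbert q)

-- The number of nodes, which will be the number of lines.
nodesᵗ : ∀ {φ} → Tree φ → ℕ
nodesᵗ (axiom _)  = 1
nodesᵗ (mp p q)   = suc (nodesᵗ p + nodesᵗ q)
nodesᵗ (inst p σ) = suc (nodesᵗ p)

Narrow : ∀ {φ} → ℕ → Tree φ → Set
Narrow W (axiom {φ} _)  = fsize φ ≤ W
Narrow W (mp p q)       = Narrow W p × Narrow W q
Narrow W (inst {φ} p σ) = fsize (φ [ σ ]ᶠ) ≤ W × Narrow W p

-- Narrowness is decidable, so it can be certified for closed trees.
narrow? : ∀ {φ} W (p : Tree φ) → Dec (Narrow W p)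
narrow? W (axiom {φ} _)  = fsize φ ≤? W
narrow? W (mp p q)       = narrow? W p ×-dec narrow? W q
narrow? W (inst {φ} p σ) = (fsize (φ [ σ ]ᶠ) ≤? W) ×-dec narrow? W p

narrow-mono : ∀ {φ W W'} (p : Tree φ) → W ≤ W' → Narrow W p → Narrow W' p
narrow-mono (axiom _)  le n        = ≤-trans n le
narrow-mono (mp p q)   le (np , nq) = narrow-mono p le np , narrow-mono q le nq
narrow-mono (inst p σ) le (n , np)  = ≤-trans n le , narrow-mono p le np

-- The conclusion of a modus ponens is a subformula of its major premiss.
root-narrow : ∀ {φ W} (p : Tree φ) → Narrow W p → fsize φ ≤ W
root-narrow (axiom _)        n         = n
root-narrow (mp {A} {B} p q) (np , nq) = ≤-trans (m≤n+m (fsize B) (fsize A)) (root-narrow p np)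
root-narrow (inst p σ)       (n , _)   = n

lines premises : ∀ {φ} → Tree φ → List FFm
lines {φ} p = φ ∷ premises p
premises (axiom _)  = []
premises (mp p q)   = lines p ++ lines q
premises (inst p σ) = lines p

-- Justifications refer to earlier lines, so they survive appending lines below.
weaken-justification : ∀ {Γ φ} Γ' → Justified Γ φ → Justified (Γ ++ Γ') φ
weaken-justification Γ' (ax a)   = ax a
weaken-justification Γ' (mp i j) = mp (∈-++⁺ˡ i) (∈-++⁺ˡ j)
weaken-justification Γ' (sb i σ) = sb (∈-++⁺ˡ i) σ

append-lines : ∀ {Γ Γ'} → sFregeLines Γ → sFregeLines Γ' → sFregeLines (Γ ++ Γ')
append-lines []                  ls' = ls'
append-lines {Γ' = Γ'} (j ∷ ls) ls' = weaken-justification Γ' j ∷ append-lines ls ls'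

lines-valid : ∀ {φ} (p : Tree φ) → sFregeLines (lines p)
lines-valid (axiom a)  = ax a ∷ []
lines-valid (mp p q)   =
  mp (∈-++⁺ˡ {ys = lines q} (here refl)) (∈-++⁺ʳ (lines p) (here refl))
  ∷ append-lines (lines-valid p) (lines-valid q)
lines-valid (inst p σ) = sb (here refl) σ ∷ lines-valid p

linearise : ∀ {φ} → Tree φ → sFregeProof φ
linearise p = premises p , lines-valid p

linearise-length : ∀ {φ} (p : Tree φ) → sFregeLength (linearise p) ≡ nodesᵗ p
linearise-length (axiom _)  = refl
linearise-length (mp p q)   =
  cong suc (trans (length-++ (lines p)) (cong₂ _+_ (linearise-length p) (linearise-length q)))
linearise-length (inst p σ) = cong suc (linearise-length p)

lines-narrow : ∀ {φ W} (p : Tree φ) → Narrow W p → All (λ ψ → fsize ψ ≤ W) (lines p)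
lines-narrow (axiom _)  n         = n ∷ []
lines-narrow (mp p q)   (np , nq) = root-narrow (mp p q) (np , nq) ∷ ++⁺ (lines-narrow p np) (lines-narrow q nq)
lines-narrow (inst p σ) (n , np)  = n ∷ lines-narrow p np

linesSize≤ : ∀ {W} Γ → All (λ ψ → fsize ψ ≤ W) Γ → linesSize Γ ≤ length Γ * W
linesSize≤ []      []       = z≤n
linesSize≤ (φ ∷ Γ) (n ∷ ns) = +-mono-≤ n (linesSize≤ Γ ns)

-- Each line has size at most the width.
linearise-size : ∀ {φ W} (p : Tree φ) → Narrow W p → sFregeSize (linearise p) ≤ nodesᵗ p * W
linearise-size {W = W} p n =
  subst (λ k → linesSize (lines p) ≤ k * W) (linearise-length p) (linesSize≤ (lines p) (lines-narrow p n))

record Proof (W L : ℕ) (φ : FFm) : Set where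
  constructor proof
  field
    tree   : Tree φ
    short  : nodesᵗ tree ≤ L
    narrow : Narrow W tree

linearise-bounded : ∀ {W L φ} → Proof W L φ →
                    Σ (sFregeProof φ) λ q → sFregeLength q ≤ L × sFregeSize q ≤ L * W
linearise-bounded {W} (proof t l n) =
  linearise t , ≤-trans (≤-reflexive (linearise-length t)) l , ≤-trans (linearise-size t n) (*-monoˡ-≤ W l)

lengthen : ∀ {W L L' φ} → L ≤ L' → Proof W L φ → Proof W L' φ
lengthen le (proof t l n) = proof t (≤-trans l le) n

infixl 9 _·ᵖ_
_·ᵖ_ : ∀ {W L₁ L₂ A B} → Proof W L₁ (A ⇒ B) → Proof W L₂ A → Proof W (suc (L₁ + L₂)) B
proof t l n ·ᵖ proof t′ l′ n′ = proof (mp t t′) (s≤s (+-mono-≤ l l′)) (n , n′)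

substitute : ∀ {W L φ} (σ : FSubst) → fsize (φ [ σ ]ᶠ) ≤ W → Proof W L φ → Proof W (suc L) (φ [ σ ]ᶠ)
substitute σ small (proof t l n) = proof (inst t σ) (s≤s l) (small , n)

fsize-pos : ∀ φ → 1 ≤ fsize φ
fsize-pos ⊤ᶠ       = s≤s z≤n
fsize-pos ⊥ᶠ       = s≤s z≤n
fsize-pos (fv _)   = s≤s z≤n
fsize-pos (φ ∨ᶠ ψ) = ≤-trans (fsize-pos φ) (m≤m+n _ _)
fsize-pos (φ ∧ᶠ ψ) = ≤-trans (fsize-pos φ) (m≤m+n _ _)
fsize-pos (φ ⇒ ψ)  = ≤-trans (fsize-pos φ) (m≤m+n _ _)
fsize-pos (¬ᶠ φ)   = fsize-pos φ

sum-bound : ∀ {a b x y M} → a ≤ x * M → b ≤ y * M → a + b ≤ (x + y) * M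
sum-bound {x = x} {y} {M} ha hb = ≤-trans (+-mono-≤ ha hb) (≤-reflexive (sym (*-distribʳ-+ M x y)))

fsize-subst : ∀ {M} (σ : FSubst) → 1 ≤ M → (∀ x → fsize (σ x) ≤ M) →
              ∀ φ → fsize (φ [ σ ]ᶠ) ≤ fsize φ * M
fsize-subst σ 1≤M small ⊤ᶠ       = ≤-trans 1≤M (m≤m+n _ 0)
fsize-subst σ 1≤M small ⊥ᶠ       = ≤-trans 1≤M (m≤m+n _ 0)
fsize-subst σ 1≤M small (fv x)   = ≤-trans (small x) (m≤m+n _ 0)
fsize-subst {M} σ 1≤M small (φ ∨ᶠ ψ) =
  sum-bound {x = fsize φ} {fsize ψ} {M} (fsize-subst σ 1≤M small φ) (fsize-subst σ 1≤M small ψ)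
fsize-subst {M} σ 1≤M small (φ ∧ᶠ ψ) =
  sum-bound {x = fsize φ} {fsize ψ} {M} (fsize-subst σ 1≤M small φ) (fsize-subst σ 1≤M small ψ)
fsize-subst {M} σ 1≤M small (φ ⇒ ψ)  =
  sum-bound {x = fsize φ} {fsize ψ} {M} (fsize-subst σ 1≤M small φ) (fsize-subst σ 1≤M small ψ)
fsize-subst σ 1≤M small (¬ᶠ φ)   = fsize-subst σ 1≤M small φ

-- Bounds on the derived schemes.  They are opaque so that the large numerals
-- are never unfolded during type checking.
opaque
  schemaWidth schemaLength : ℕ
  schemaWidth  = 128
  schemaLength = 1000

  instance
    schemaWidth-nonZero : NonZero schemaWidth
    schemaWidth-nonZero = _

record Schema (φ : FFm) : Set where
  field
    body        : Tree φ
    body-narrow : Narrow schemaWidth body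
    body-short  : nodesᵗ body < schemaLength
open Schema

certify : ∀ {φ} (d : [] ⊢ φ) →
          {True (narrow? schemaWidth (fromHilbert d))} → {True (nodesᵗ (fromHilbert d) <? schemaLength)} → Schema φ
certify d {narrow} {short} = record { body = fromHilbert d ; body-narrow = toWitness narrow ; body-short = toWitness short }

τ : FFm → FFm → FFm → FSubst
τ A B C (inj₂ 0) = A
τ A B C (inj₂ 1) = B
τ A B C (inj₂ 2) = C
τ A B C _        = ⊤ᶠ

at : ∀ {M φ} → Schema φ → ∀ A B C → fsize A ≤ M → fsize B ≤ M → fsize C ≤ M →
     Proof (schemaWidth * M) schemaLength (φ [ τ A B C ]ᶠ)
at {M} {φ} S A B C hA hB hC =
  proof (inst (body S) (τ A B C)) (body-short S)
        ( ≤-trans (fsize-subst (τ A B C) 1≤M small φ) (*-monoˡ-≤ M (root-narrow (body S) (body-narrow S)))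
        , narrow-mono (body S) (≤-trans (≤-reflexive (sym (*-identityʳ schemaWidth))) (*-monoʳ-≤ schemaWidth 1≤M))
                      (body-narrow S))
  where
  1≤M : 1 ≤ M
  1≤M = ≤-trans (fsize-pos A) hA
  small : ∀ x → fsize (τ A B C x) ≤ M
  small (inj₂ 0) = hA
  small (inj₂ 1) = hB
  small (inj₂ 2) = hC
  small (inj₂ (suc (suc (suc _)))) = 1≤M
  small (inj₁ _) = 1≤M

at₁ : ∀ {M φ} → Schema φ → ∀ A → fsize A ≤ M → Proof (schemaWidth * M) schemaLength (φ [ τ A A A ]ᶠ)
at₁ S A hA = at S A A A hA hA hA

at₂ : ∀ {M φ} → Schema φ → ∀ A B → fsize A ≤ M → fsize B ≤ M →
      Proof (schemaWidth * M) schemaLength (φ [ τ A B A ]ᶠ)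
at₂ S A B hA hB = at S A B A hA hB hA

opaque
  unfolding schemaWidth schemaLength

  schema-⊤ : Schema ⊤ᶠ
  schema-⊤ = certify ⊢-⊤
  schema-id : Schema (fA ⇒ fA)
  schema-id = certify (⊢-id fA)
  schema-⊥-elim : Schema (⊥ᶠ ⇒ fA)
  schema-⊥-elim = certify (ded (ax (F2 fA (¬ᶠ fA)) · (ax (F14 fA) · h₀)))
  schema-⊤-intro : Schema (fA ⇒ ⊤ᶠ)
  schema-⊤-intro = certify (ax (F8 ⊤ᶠ fA) · ⊢-⊤)
  schema-trans : Schema ((fA ⇒ fB) ⇒ ((fB ⇒ fC) ⇒ (fA ⇒ fC)))
  schema-trans = certify (ded (ded (ded (h₁ · (h₂ · h₀)))))
  schema-∨-elim : Schema ((fA ⇒ fC) ⇒ ((fB ⇒ fC) ⇒ ((fA ∨ᶠ fB) ⇒ fC)))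
  schema-∨-elim = certify (ax (F11 fA fB fC))
  schema-∧-intro : Schema ((fA ⇒ fB) ⇒ ((fA ⇒ fC) ⇒ (fA ⇒ (fB ∧ᶠ fC))))
  schema-∧-intro = certify (ded (ded (ded (ax (F1 fB fC) · (h₂ · h₀) · (h₁ · h₀)))))
  schema-∨-introˡ : Schema ((fA ⇒ fB) ⇒ (fA ⇒ (fB ∨ᶠ fC)))
  schema-∨-introˡ = certify (ded (ded (ax (F4 fB fC) · (h₁ · h₀))))
  schema-∨-introʳ : Schema ((fA ⇒ fC) ⇒ (fA ⇒ (fB ∨ᶠ fC)))
  schema-∨-introʳ = certify (ded (ded (ax (F5 fB fC) · (h₁ · h₀))))
  schema-∧-elimˡ : Schema ((fA ⇒ fC) ⇒ ((fA ∧ᶠ fB) ⇒ fC))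
  schema-∧-elimˡ = certify (ded (ded (h₁ · (ax (F2 fA fB) · h₀))))
  schema-∧-elimʳ : Schema ((fB ⇒ fC) ⇒ ((fA ∧ᶠ fB) ⇒ fC))
  schema-∧-elimʳ = certify (ded (ded (h₁ · (ax (F3 fA fB) · h₀))))
  schema-switch : Schema ((fA ∧ᶠ (fB ∨ᶠ fC)) ⇒ ((fA ∧ᶠ fB) ∨ᶠ fC))
  schema-switch = certify (ded (ax (F11 fB fC ((fA ∧ᶠ fB) ∨ᶠ fC))
                                · ded (ax (F4 (fA ∧ᶠ fB) fC) · (ax (F1 fA fB) · (ax (F2 fA (fB ∨ᶠ fC)) · h₁) · h₀))
                                · ax (F5 (fA ∧ᶠ fB) fC)
                                · (ax (F3 fA (fB ∨ᶠ fC)) · h₀)))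
  schema-contract : Schema ((fA ∨ᶠ fA) ⇒ fA)
  schema-contract = certify (ax (F11 fA fA fA) · ⊢-id fA · ⊢-id fA)
  schema-cocontract : Schema (fA ⇒ (fA ∧ᶠ fA))
  schema-cocontract = certify (ded (ax (F1 fA fA) · h₀ · h₀))
  schema-excluded-middle : Schema (⊤ᶠ ⇒ (fA ∨ᶠ ¬ᶠ fA))
  schema-excluded-middle = certify (ax (F16 fA))
  schema-noncontradiction : Schema ((fA ∧ᶠ ¬ᶠ fA) ⇒ ⊥ᶠ)
  schema-noncontradiction = certify (ax (F15 fA))
  schema-¬¬-elim : Schema ((¬ᶠ ¬ᶠ fA) ⇒ fA)
  schema-¬¬-elim = certify (ax (F6 fA))
  schema-¬¬-intro : Schema (fA ⇒ (¬ᶠ ¬ᶠ fA))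
  schema-¬¬-intro = certify (ax (F7 fA))
  schema-¬⊤ : Schema ((¬ᶠ ⊤ᶠ) ⇒ ⊥ᶠ)
  schema-¬⊤ = certify (ded (ax (F9 ⊤ᶠ ⊥ᶠ) · h₀ · ⊢-weaken ⊢-⊤))
  schema-¬⊥ : Schema (⊤ᶠ ⇒ (¬ᶠ ⊥ᶠ))
  schema-¬⊥ = certify (ax (F8 (¬ᶠ ⊥ᶠ) ⊤ᶠ)
                       · raa (ded (ax (F2 (¬ᶠ ⊥ᶠ) (¬ᶠ ¬ᶠ ⊥ᶠ)) · (ax (F14 (¬ᶠ ⊥ᶠ)) · (ax (F6 ⊥ᶠ) · h₀)))))
  schema-¬∨ : Schema ((¬ᶠ (fA ∨ᶠ fB)) ⇒ ((¬ᶠ fA) ∧ᶠ (¬ᶠ fB)))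
  schema-¬∨ = certify (ded (ax (F1 (¬ᶠ fA) (¬ᶠ fB)) · (ax (F13 fA (fA ∨ᶠ fB)) · ax (F4 fA fB) · h₀)
                                                    · (ax (F13 fB (fA ∨ᶠ fB)) · ax (F5 fA fB) · h₀)))
  schema-¬∧ : Schema ((¬ᶠ (fA ∧ᶠ fB)) ⇒ ((¬ᶠ fA) ∨ᶠ (¬ᶠ fB)))
  schema-¬∧ = certify (ded (raa (ded (ax (F9 (fA ∧ᶠ fB) ((¬ᶠ fA) ∨ᶠ (¬ᶠ fB))) · h₁ · (ax (F1 fA fB) · byA · byB)))))
    where
    byA : ((¬ᶠ ((¬ᶠ fA) ∨ᶠ (¬ᶠ fB))) ∷ (¬ᶠ (fA ∧ᶠ fB)) ∷ []) ⊢ fA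
    byA = ax (F6 fA) · (ax (F13 (¬ᶠ fA) ((¬ᶠ fA) ∨ᶠ (¬ᶠ fB))) · ax (F4 (¬ᶠ fA) (¬ᶠ fB)) · h₀)
    byB : ((¬ᶠ ((¬ᶠ fA) ∨ᶠ (¬ᶠ fB))) ∷ (¬ᶠ (fA ∧ᶠ fB)) ∷ []) ⊢ fB
    byB = ax (F6 fB) · (ax (F13 (¬ᶠ fB) ((¬ᶠ fA) ∨ᶠ (¬ᶠ fB))) · ax (F5 (¬ᶠ fA) (¬ᶠ fB)) · h₀)
  schema-∧¬ : Schema (((¬ᶠ fA) ∧ᶠ (¬ᶠ fB)) ⇒ (¬ᶠ (fA ∨ᶠ fB)))
  schema-∧¬ = certify (ded (raa (ded (ax (F11 fA fB (¬ᶠ (fA ∨ᶠ fB)))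
                                      · (ax (F9 fA (¬ᶠ (fA ∨ᶠ fB))) · (ax (F2 (¬ᶠ fA) (¬ᶠ fB)) · h₁))
                                      · (ax (F9 fB (¬ᶠ (fA ∨ᶠ fB))) · (ax (F3 (¬ᶠ fA) (¬ᶠ fB)) · h₁))
                                      · (ax (F6 (fA ∨ᶠ fB)) · h₀)))))
  schema-∨¬ : Schema (((¬ᶠ fA) ∨ᶠ (¬ᶠ fB)) ⇒ (¬ᶠ (fA ∧ᶠ fB)))
  schema-∨¬ = certify (ax (F11 (¬ᶠ fA) (¬ᶠ fB) (¬ᶠ (fA ∧ᶠ fB)))
                       · (ax (F13 (fA ∧ᶠ fB) fA) · ax (F2 fA fB))
                       · (ax (F13 (fA ∧ᶠ fB) fB) · ax (F3 fA fB)))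

size-pos : ∀ α → 1 ≤ size α
size-pos 𝕗          = s≤s z≤n
size-pos 𝕥          = s≤s z≤n
size-pos (atom _ _) = s≤s z≤n
size-pos (var _ _)  = s≤s z≤n
size-pos (α ∨ β)    = ≤-trans (size-pos α) (m≤m+n _ _)
size-pos (α ∧ β)    = ≤-trans (size-pos α) (m≤m+n _ _)

size-dual : ∀ α → size (dual α) ≡ size α
size-dual 𝕗          = refl
size-dual 𝕥          = refl
size-dual (atom _ _) = refl
size-dual (var _ _)  = refl
size-dual (α ∨ β)    = cong₂ _+_ (size-dual α) (size-dual β)
size-dual (α ∧ β)    = cong₂ _+_ (size-dual α) (size-dual β)

fsize-tr : ∀ α → fsize (tr α) ≡ size α
fsize-tr 𝕗              = refl
fsize-tr 𝕥              = refl
fsize-tr (atom true _)  = refl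
fsize-tr (atom false _) = refl
fsize-tr (var true _)   = refl
fsize-tr (var false _)  = refl
fsize-tr (α ∨ β)        = cong₂ _+_ (fsize-tr α) (fsize-tr β)
fsize-tr (α ∧ β)        = cong₂ _+_ (fsize-tr α) (fsize-tr β)

size-ctx : ∀ ξ γ → size γ ≤ size (ξ ⟪ γ ⟫)
size-ctx □        γ = ≤-refl
size-ctx (ξ ∨ₗ β) γ = ≤-trans (size-ctx ξ γ) (m≤m+n _ _)
size-ctx (α ∨ᵣ ξ) γ = ≤-trans (size-ctx ξ γ) (m≤n+m _ _)
size-ctx (ξ ∧ₗ β) γ = ≤-trans (size-ctx ξ γ) (m≤m+n _ _)
size-ctx (α ∧ᵣ ξ) γ = ≤-trans (size-ctx ξ γ) (m≤n+m _ _)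

-- The number of nodes of the syntax tree.  Recursions over a formula spend a
-- fixed number of combinators per node, so their cost is measured by nodes.
nodes : Fm → ℕ
nodes (α ∨ β) = suc (nodes α + nodes β)
nodes (α ∧ β) = suc (nodes α + nodes β)
nodes _       = 1

nodes-pos : ∀ α → 1 ≤ nodes α
nodes-pos (α ∨ β)    = s≤s z≤n
nodes-pos (α ∧ β)    = s≤s z≤n
nodes-pos 𝕗          = s≤s z≤n
nodes-pos 𝕥          = s≤s z≤n
nodes-pos (atom _ _) = s≤s z≤n
nodes-pos (var _ _)  = s≤s z≤n

nodes-dual : ∀ α → nodes (dual α) ≡ nodes α
nodes-dual 𝕗          = refl
nodes-dual 𝕥          = refl
nodes-dual (atom _ _) = refl
nodes-dual (var _ _)  = refl
nodes-dual (α ∨ β)    = cong suc (cong₂ _+_ (nodes-dual α) (nodes-dual β))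
nodes-dual (α ∧ β)    = cong suc (cong₂ _+_ (nodes-dual α) (nodes-dual β))

binary-node : ∀ {n₁ n₂ s₁ s₂} → suc n₁ ≡ 2 * s₁ → suc n₂ ≡ 2 * s₂ →
              suc (suc (n₁ + n₂)) ≡ 2 * (s₁ + s₂)
binary-node {n₁} {n₂} {s₁} {s₂} e₁ e₂ = begin
  suc (suc (n₁ + n₂)) ≡⟨ cong suc (sym (+-suc n₁ n₂)) ⟩
  suc n₁ + suc n₂     ≡⟨ cong₂ _+_ e₁ e₂ ⟩
  2 * s₁ + 2 * s₂     ≡⟨ sym (*-distribˡ-+ 2 s₁ s₂) ⟩
  2 * (s₁ + s₂)       ∎
  where open ≡-Reasoning

suc-nodes : ∀ α → suc (nodes α) ≡ 2 * size α
suc-nodes 𝕗          = refl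
suc-nodes 𝕥          = refl
suc-nodes (atom _ _) = refl
suc-nodes (var _ _)  = refl
suc-nodes (α ∨ β)    = binary-node {s₁ = size α} {s₂ = size β} (suc-nodes α) (suc-nodes β)
suc-nodes (α ∧ β)    = binary-node {s₁ = size α} {s₂ = size β} (suc-nodes α) (suc-nodes β)

nodes-fit : ∀ {M} α → size α ≤ M → nodes α ≤ 2 * M
nodes-fit α h = ≤-trans (n≤1+n (nodes α)) (≤-trans (≤-reflexive (suc-nodes α)) (*-monoʳ-≤ 2 h))

-- The depth of the hole of a context: lifting an implication through a
-- context costs a fixed number of units per level.
depth : Ctx → ℕ
depth □        = 0
depth (ξ ∨ₗ _) = suc (depth ξ)
depth (_ ∨ᵣ ξ) = suc (depth ξ)
depth (ξ ∧ₗ _) = suc (depth ξ)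
depth (_ ∧ᵣ ξ) = suc (depth ξ)

depth≤nodes : ∀ ξ γ → depth ξ ≤ nodes (ξ ⟪ γ ⟫)
depth≤nodes □        γ = z≤n
depth≤nodes (ξ ∨ₗ β) γ = s≤s (≤-trans (depth≤nodes ξ γ) (m≤m+n _ _))
depth≤nodes (α ∨ᵣ ξ) γ = s≤s (≤-trans (depth≤nodes ξ γ) (m≤n+m _ _))
depth≤nodes (ξ ∧ₗ β) γ = s≤s (≤-trans (depth≤nodes ξ γ) (m≤m+n _ _))
depth≤nodes (α ∧ᵣ ξ) γ = s≤s (≤-trans (depth≤nodes ξ γ) (m≤n+m _ _))

-- The Frege substitution corresponding to a CoS substitution.  It sends the
-- negated variable Ā to a negation, where CoS has the dual of σ(A).
σᶠ : Subst → FSubst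
σᶠ σ (inj₁ a) = fv (inj₁ a)
σᶠ σ (inj₂ A) = tr (σ A)

fsize-tr-subst : ∀ γ σ → fsize (tr γ [ σᶠ σ ]ᶠ) ≡ size (γ [ σ ])
fsize-tr-subst 𝕗              σ = refl
fsize-tr-subst 𝕥              σ = refl
fsize-tr-subst (atom true a)  σ = refl
fsize-tr-subst (atom false a) σ = refl
fsize-tr-subst (var true A)   σ = fsize-tr (σ A)
fsize-tr-subst (var false A)  σ = trans (fsize-tr (σ A)) (sym (size-dual (σ A)))
fsize-tr-subst (γ ∨ δ)        σ = cong₂ _+_ (fsize-tr-subst γ σ) (fsize-tr-subst δ σ)
fsize-tr-subst (γ ∧ δ)        σ = cong₂ _+_ (fsize-tr-subst γ σ) (fsize-tr-subst δ σ)

first-sizeE : ∀ {α γ} (d : ChainE sSKSgStep α γ) → size α ≤ sizeE sSKSgStep d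
first-sizeE (stopE α) = ≤-refl
first-sizeE (eqE e d) = m≤m+n _ _

first-sizeR : ∀ {α γ} (d : ChainR sSKSgStep α γ) → size α ≤ sizeR sSKSgStep d
first-sizeR (stopR α)  = ≤-refl
first-sizeR (rlR st d) = m≤m+n _ _

derivationSize-pos : ∀ {α γ} (d : Derivation sSKSgStep α γ) → 1 ≤ derivationSize sSKSgStep d
derivationSize-pos {α} (inj₁ d) = ≤-trans (size-pos α) (first-sizeE d)
derivationSize-pos {α} (inj₂ d) = ≤-trans (size-pos α) (first-sizeR d)

-- A cut-free calculus for the order underlying CoS equality.  Every rule
-- decomposes one side, so derivations are bounded by the formulae.
infix 3 _⊑_
data _⊑_ : Fm → Fm → Set where
  ⊥⊑    : ∀ {y} → 𝕗 ⊑ y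
  ⊑⊤    : ∀ {x} → x ⊑ 𝕥
  atom⊑ : ∀ {b a} → atom b a ⊑ atom b a
  var⊑  : ∀ {b A} → var b A ⊑ var b A
  ∨⊑    : ∀ {α β y} → α ⊑ y → β ⊑ y → (α ∨ β) ⊑ y
  ⊑∧    : ∀ {x α β} → x ⊑ α → x ⊑ β → x ⊑ (α ∧ β)
  ⊑∨ˡ   : ∀ {x α β} → x ⊑ α → x ⊑ (α ∨ β)
  ⊑∨ʳ   : ∀ {x α β} → x ⊑ β → x ⊑ (α ∨ β)
  ∧ˡ⊑   : ∀ {α β y} → α ⊑ y → (α ∧ β) ⊑ y
  ∧ʳ⊑   : ∀ {α β y} → β ⊑ y → (α ∧ β) ⊑ y

⊑-refl : ∀ x → x ⊑ x
⊑-refl 𝕗          = ⊥⊑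
⊑-refl 𝕥          = ⊑⊤
⊑-refl (atom b a) = atom⊑
⊑-refl (var b A)  = var⊑
⊑-refl (α ∨ β)    = ∨⊑ (⊑∨ˡ (⊑-refl α)) (⊑∨ʳ (⊑-refl β))
⊑-refl (α ∧ β)    = ⊑∧ (∧ˡ⊑ (⊑-refl α)) (∧ʳ⊑ (⊑-refl β))

⊑-trans : ∀ {x y z} → x ⊑ y → y ⊑ z → x ⊑ z
⊑-trans ⊥⊑          e           = ⊥⊑
⊑-trans d           ⊑⊤          = ⊑⊤
⊑-trans (∨⊑ d₁ d₂)  e           = ∨⊑ (⊑-trans d₁ e) (⊑-trans d₂ e)
⊑-trans (∧ˡ⊑ d)     e           = ∧ˡ⊑ (⊑-trans d e)
⊑-trans (∧ʳ⊑ d)     e           = ∧ʳ⊑ (⊑-trans d e)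
⊑-trans d           (⊑∧ e₁ e₂)  = ⊑∧ (⊑-trans d e₁) (⊑-trans d e₂)
⊑-trans d           (⊑∨ˡ e)     = ⊑∨ˡ (⊑-trans d e)
⊑-trans d           (⊑∨ʳ e)     = ⊑∨ʳ (⊑-trans d e)
⊑-trans atom⊑       atom⊑       = atom⊑
⊑-trans var⊑        var⊑        = var⊑
⊑-trans (⊑∧ d₁ d₂)  (∧ˡ⊑ e)     = ⊑-trans d₁ e
⊑-trans (⊑∧ d₁ d₂)  (∧ʳ⊑ e)     = ⊑-trans d₂ e
⊑-trans (⊑∨ˡ d)     (∨⊑ e₁ e₂)  = ⊑-trans d e₁
⊑-trans (⊑∨ʳ d)     (∨⊑ e₁ e₂)  = ⊑-trans d e₂

≈⇒⊑ : ∀ {α β} → α ≈ β → (α ⊑ β) × (β ⊑ α)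
≈⇒⊑ {α} ≈-refl = ⊑-refl α , ⊑-refl α
≈⇒⊑ (≈-sym e) = proj₂ (≈⇒⊑ e) , proj₁ (≈⇒⊑ e)
≈⇒⊑ (≈-trans e f) = ⊑-trans (proj₁ (≈⇒⊑ e)) (proj₁ (≈⇒⊑ f)) , ⊑-trans (proj₂ (≈⇒⊑ f)) (proj₂ (≈⇒⊑ e))
≈⇒⊑ (∨-cong e f) =
  ∨⊑ (⊑∨ˡ (proj₁ (≈⇒⊑ e))) (⊑∨ʳ (proj₁ (≈⇒⊑ f))) , ∨⊑ (⊑∨ˡ (proj₂ (≈⇒⊑ e))) (⊑∨ʳ (proj₂ (≈⇒⊑ f)))
≈⇒⊑ (∧-cong e f) =
  ⊑∧ (∧ˡ⊑ (proj₁ (≈⇒⊑ e))) (∧ʳ⊑ (proj₁ (≈⇒⊑ f))) , ⊑∧ (∧ˡ⊑ (proj₂ (≈⇒⊑ e))) (∧ʳ⊑ (proj₂ (≈⇒⊑ f)))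
≈⇒⊑ (∨-comm {α} {β}) = ∨⊑ (⊑∨ʳ (⊑-refl α)) (⊑∨ˡ (⊑-refl β)) , ∨⊑ (⊑∨ʳ (⊑-refl β)) (⊑∨ˡ (⊑-refl α))
≈⇒⊑ (∧-comm {α} {β}) = ⊑∧ (∧ʳ⊑ (⊑-refl β)) (∧ˡ⊑ (⊑-refl α)) , ⊑∧ (∧ʳ⊑ (⊑-refl α)) (∧ˡ⊑ (⊑-refl β))
≈⇒⊑ (∨-assoc {α} {β} {γ}) =
  ∨⊑ (∨⊑ (⊑∨ˡ (⊑-refl α)) (⊑∨ʳ (⊑∨ˡ (⊑-refl β)))) (⊑∨ʳ (⊑∨ʳ (⊑-refl γ))) ,
  ∨⊑ (⊑∨ˡ (⊑∨ˡ (⊑-refl α))) (∨⊑ (⊑∨ˡ (⊑∨ʳ (⊑-refl β))) (⊑∨ʳ (⊑-refl γ)))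
≈⇒⊑ (∧-assoc {α} {β} {γ}) =
  ⊑∧ (∧ˡ⊑ (∧ˡ⊑ (⊑-refl α))) (⊑∧ (∧ˡ⊑ (∧ʳ⊑ (⊑-refl β))) (∧ʳ⊑ (⊑-refl γ))) ,
  ⊑∧ (⊑∧ (∧ˡ⊑ (⊑-refl α)) (∧ʳ⊑ (∧ˡ⊑ (⊑-refl β)))) (∧ʳ⊑ (∧ʳ⊑ (⊑-refl γ)))
≈⇒⊑ (∨-unit {α}) = ∨⊑ (⊑-refl α) ⊥⊑ , ⊑∨ˡ (⊑-refl α)
≈⇒⊑ (∧-unit {α}) = ∧ˡ⊑ (⊑-refl α) , ⊑∧ (⊑-refl α) ⊑⊤
≈⇒⊑ 𝕥∨𝕥 = ⊑⊤ , ⊑∨ˡ ⊑⊤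
≈⇒⊑ 𝕗∧𝕗 = ∧ˡ⊑ ⊥⊑ , ⊥⊑

-- Cost accounting.  A ⊑-derivation is charged the product of the node
-- counts: splitting one side into parts of a and b nodes leaves one spare
-- unit because the other side has c ≥ 1 nodes.
split-costˡ : ∀ a b c → 1 ≤ c → suc (a * c + b * c) ≤ suc (a + b) * c
split-costˡ a b c 1≤c = begin
  suc (a * c + b * c) ≡⟨ cong suc (sym (*-distribʳ-+ c a b)) ⟩
  1 + (a + b) * c     ≤⟨ +-monoˡ-≤ ((a + b) * c) 1≤c ⟩
  c + (a + b) * c     ∎
  where open ≤-Reasoning

split-costʳ : ∀ a b c → 1 ≤ c → suc (c * a + c * b) ≤ c * suc (a + b)
split-costʳ a b c 1≤c = begin
  suc (c * a + c * b) ≡⟨ cong suc (cong₂ _+_ (*-comm c a) (*-comm c b)) ⟩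
  suc (a * c + b * c) ≤⟨ split-costˡ a b c 1≤c ⟩
  suc (a + b) * c     ≡⟨ *-comm (suc (a + b)) c ⟩
  c * suc (a + b)     ∎
  where open ≤-Reasoning

shrink-costˡ : ∀ a b c → 1 ≤ c → suc (a * c) ≤ suc (a + b) * c × suc (b * c) ≤ suc (a + b) * c
shrink-costˡ a b c 1≤c =
  ≤-trans (s≤s (m≤m+n (a * c) (b * c))) (split-costˡ a b c 1≤c) ,
  ≤-trans (s≤s (m≤n+m (b * c) (a * c))) (split-costˡ a b c 1≤c)

shrink-costʳ : ∀ a b c → 1 ≤ c → suc (c * a) ≤ c * suc (a + b) × suc (c * b) ≤ c * suc (a + b)
shrink-costʳ a b c 1≤c =
  ≤-trans (s≤s (m≤m+n (c * a) (c * b))) (split-costʳ a b c 1≤c) ,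
  ≤-trans (s≤s (m≤n+m (c * b) (c * a))) (split-costʳ a b c 1≤c)

-- A De Morgan step (a scheme composed with a monotonicity step, in either
-- order) and a monotonicity step fit in five units per node.
de-morgan-cost₁ : ∀ a b → suc (1 + suc (suc (a * 5) + suc (b * 5))) ≡ suc (a + b) * 5
de-morgan-cost₁ = solve-∀

de-morgan-cost₂ : ∀ a b → suc (suc (suc (a * 5) + suc (b * 5)) + 1) ≡ suc (a + b) * 5
de-morgan-cost₂ = solve-∀

mono-cost : ∀ a b → 2 + suc (suc (a * 5) + suc (b * 5)) ≡ suc (a + b) * 5
mono-cost = solve-∀

five-nodes : ∀ {M} α → size α ≤ M → nodes α * 5 ≤ 10 * M
five-nodes {M} α h = ≤-trans (*-monoˡ-≤ 5 (nodes-fit α h)) (≤-reflexive (ten M))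
  where
  ten : ∀ M → 2 * M * 5 ≡ 10 * M
  ten = solve-∀

-- Every simulated step uses at most 64 M² units, M bounding all sizes.
budget-square : ∀ {M a b} → a ≤ 2 * M → b ≤ 2 * M → a * b ≤ 64 * (M * M)
budget-square {M} ha hb =
  ≤-trans (*-mono-≤ ha hb) (≤-trans (≤-reflexive (square M)) (*-monoˡ-≤ (M * M) (m≤m+n 4 60)))
  where
  square : ∀ M → 2 * M * (2 * M) ≡ 4 * (M * M)
  square = solve-∀

budget-linear : ∀ {M k} → k ≤ 64 → 1 ≤ M → k * M ≤ 64 * (M * M)
budget-linear {M} k≤64 1≤M = *-mono-≤ k≤64 (≤-trans (≤-reflexive (sym (*-identityˡ M))) (*-monoˡ-≤ M 1≤M))

budget-rule : ∀ {M d} → d ≤ 2 * M → 1 ≤ M → d * 4 + (6 + 10 * M) ≤ 24 * M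
budget-rule {M} d≤ 1≤M =
  ≤-trans (+-mono-≤ (*-monoˡ-≤ 4 d≤) (+-monoˡ-≤ (10 * M) (*-monoʳ-≤ 6 1≤M))) (≤-reflexive (sum M))
  where
  sum : ∀ M → 2 * M * 4 + (6 * M + 10 * M) ≡ 24 * M
  sum = solve-∀

-- In a chain, the first formula (of size a ≥ 1) pays for the step after it.
chain-cost : ∀ a r S L → 1 ≤ a → r * S + (S + L) ≤ (a + r) * S + L
chain-cost a r S L 1≤a = begin
  r * S + (S + L)   ≡⟨ sym (+-assoc (r * S) S L) ⟩
  r * S + S + L     ≡⟨ cong (_+ L) (+-comm (r * S) S) ⟩
  S + r * S + L     ≤⟨ +-monoˡ-≤ L (+-monoˡ-≤ (r * S) (≤-trans (m≤m+n S 0) (*-monoˡ-≤ S 1≤a))) ⟩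
  a * S + r * S + L ≡⟨ cong (_+ L) (sym (*-distribʳ-+ S a r)) ⟩
  (a + r) * S + L   ∎
  where open ≤-Reasoning

left≤ : ∀ {a b M} → a + b ≤ M → a ≤ M
left≤ {a} {b} h = ≤-trans (m≤m+n a b) h

right≤ : ∀ {a b M} → a + b ≤ M → b ≤ M
right≤ {a} {b} h = ≤-trans (m≤n+m b a) h

-- One unit of cost: a scheme instance and at most two modus ponens.
κ : ℕ
κ = 2 + schemaLength

-- A calculus of implications between formulae of size at most M, realised by
-- proofs of width schemaWidth * M; each combinator is one unit (κ lines).
module Implications (M : ℕ) where

  W : ℕ
  W = schemaWidth * M

  record Imp (u : ℕ) (X Y : FFm) : Set where
    constructor imp
    field
      derivation : Proof W (u * κ) (X ⇒ Y)
      src        : fsize X ≤ M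
      tgt        : fsize Y ≤ M
  open Imp public

  raise : ∀ {u u' X Y} → u ≤ u' → Imp u X Y → Imp u' X Y
  raise le (imp d hX hY) = imp (lengthen (*-monoˡ-≤ κ le) d) hX hY

  apply₀ : ∀ {X Y} → Proof W schemaLength (X ⇒ Y) → fsize X ≤ M → fsize Y ≤ M → Imp 1 X Y
  apply₀ d = imp (lengthen (≤-trans (m≤n+m schemaLength 2) (m≤m+n κ 0)) d)

  apply₁ : ∀ {u X Y X' Y'} → Proof W schemaLength ((X ⇒ Y) ⇒ (X' ⇒ Y')) → Imp u X Y →
           fsize X' ≤ M → fsize Y' ≤ M → Imp (suc u) X' Y'
  apply₁ {u} f (imp d _ _) = imp (lengthen (+-monoˡ-≤ (u * κ) (n≤1+n (suc schemaLength))) (f ·ᵖ d))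

  apply₂ : ∀ {u₁ u₂ X₁ Y₁ X₂ Y₂ X Y} →
           Proof W schemaLength ((X₁ ⇒ Y₁) ⇒ ((X₂ ⇒ Y₂) ⇒ (X ⇒ Y))) → Imp u₁ X₁ Y₁ → Imp u₂ X₂ Y₂ → fsize X ≤ M → fsize Y ≤ M → Imp (suc (u₁ + u₂)) X Y
  apply₂ {u₁} {u₂} f (imp d _ _) (imp e _ _) = imp (lengthen (≤-reflexive cost) (f ·ᵖ d ·ᵖ e))
    where
    cost : suc (suc (schemaLength + u₁ * κ) + u₂ * κ) ≡ suc (u₁ + u₂) * κ
    cost = cong (2 +_) (trans (+-assoc schemaLength (u₁ * κ) (u₂ * κ))
                              (cong (schemaLength +_) (sym (*-distribʳ-+ κ u₁ u₂))))

  id⇒ : ∀ {X} → fsize X ≤ M → Imp 1 X X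
  id⇒ {X} h = apply₀ (at₁ schema-id X h) h h

  ⊥⇒ : ∀ {X} → fsize X ≤ M → Imp 1 ⊥ᶠ X
  ⊥⇒ {X} h = apply₀ (at₁ schema-⊥-elim X h) (≤-trans (fsize-pos X) h) h

  ⇒⊤ : ∀ {X} → fsize X ≤ M → Imp 1 X ⊤ᶠ
  ⇒⊤ {X} h = apply₀ (at₁ schema-⊤-intro X h) h (≤-trans (fsize-pos X) h)

  infixr 4 _⨾_
  _⨾_ : ∀ {u₁ u₂ X Y Z} → Imp u₁ X Y → Imp u₂ Y Z → Imp (suc (u₁ + u₂)) X Z
  _⨾_ {X = X} {Y} {Z} p q = apply₂ (at schema-trans X Y Z (src p) (tgt p) (tgt q)) p q (src p) (tgt q)

  ∨-elim : ∀ {u₁ u₂ X Y Z} → Imp u₁ X Z → Imp u₂ Y Z → fsize (X ∨ᶠ Y) ≤ M →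
           Imp (suc (u₁ + u₂)) (X ∨ᶠ Y) Z
  ∨-elim {X = X} {Y} {Z} p q h = apply₂ (at schema-∨-elim X Y Z (src p) (src q) (tgt p)) p q h (tgt p)

  ∧-intro : ∀ {u₁ u₂ X Y Z} → Imp u₁ X Y → Imp u₂ X Z → fsize (Y ∧ᶠ Z) ≤ M →
            Imp (suc (u₁ + u₂)) X (Y ∧ᶠ Z)
  ∧-intro {X = X} {Y} {Z} p q h = apply₂ (at schema-∧-intro X Y Z (src p) (tgt p) (tgt q)) p q (src p) h

  ∨-introˡ : ∀ {u X Y Z} → Imp u X Y → fsize (Y ∨ᶠ Z) ≤ M → Imp (suc u) X (Y ∨ᶠ Z)
  ∨-introˡ {X = X} {Y} {Z} p h = apply₁ (at schema-∨-introˡ X Y Z (src p) (tgt p) (right≤ h)) p (src p) h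

  ∨-introʳ : ∀ {u X Y Z} → Imp u X Z → fsize (Y ∨ᶠ Z) ≤ M → Imp (suc u) X (Y ∨ᶠ Z)
  ∨-introʳ {X = X} {Y} {Z} p h = apply₁ (at schema-∨-introʳ X Y Z (src p) (left≤ h) (tgt p)) p (src p) h

  ∧-elimˡ : ∀ {u X Y Z} → Imp u X Z → fsize (X ∧ᶠ Y) ≤ M → Imp (suc u) (X ∧ᶠ Y) Z
  ∧-elimˡ {X = X} {Y} {Z} p h = apply₁ (at schema-∧-elimˡ X Y Z (src p) (right≤ h) (tgt p)) p h (tgt p)

  ∧-elimʳ : ∀ {u X Y Z} → Imp u Y Z → fsize (X ∧ᶠ Y) ≤ M → Imp (suc u) (X ∧ᶠ Y) Z
  ∧-elimʳ {X = X} {Y} {Z} p h = apply₁ (at schema-∧-elimʳ X Y Z (left≤ h) (src p) (tgt p)) p h (tgt p)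

  mono∨ : ∀ {u₁ u₂ X Y X' Y'} → Imp u₁ X X' → Imp u₂ Y Y' → fsize (X ∨ᶠ Y) ≤ M → fsize (X' ∨ᶠ Y') ≤ M →
          Imp (suc (suc u₁ + suc u₂)) (X ∨ᶠ Y) (X' ∨ᶠ Y')
  mono∨ p q h h' = ∨-elim (∨-introˡ p h') (∨-introʳ q h') h

  mono∧ : ∀ {u₁ u₂ X Y X' Y'} → Imp u₁ X X' → Imp u₂ Y Y' → fsize (X ∧ᶠ Y) ≤ M → fsize (X' ∧ᶠ Y') ≤ M →
          Imp (suc (suc u₁ + suc u₂)) (X ∧ᶠ Y) (X' ∧ᶠ Y')
  mono∧ p q h h' = ∧-intro (∧-elimˡ p h) (∧-elimʳ q h) h'

module Simulation (M : ℕ) where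

  open Implications M

  fits : ∀ α → size α ≤ M → fsize (tr α) ≤ M
  fits α h = subst (_≤ M) (sym (fsize-tr α)) h

  fits-dual : ∀ α → size α ≤ M → fsize (tr (dual α)) ≤ M
  fits-dual α h = fits (dual α) (subst (_≤ M) (sym (size-dual α)) h)

  fits-with-negation : ∀ α → size α + size (dual α) ≤ M → fsize (tr α) + fsize (¬ᶠ tr α) ≤ M
  fits-with-negation α h = subst (_≤ M) (sym (cong₂ _+_ (fsize-tr α) (trans (fsize-tr α) (sym (size-dual α))))) h

  ¬tr⇒dual : ∀ α → size α ≤ M → Imp (nodes α * 5) (¬ᶠ tr α) (tr (dual α))
  ¬tr⇒dual 𝕗              h = raise (s≤s z≤n) (⇒⊤ {¬ᶠ ⊥ᶠ} h)
  ¬tr⇒dual 𝕥              h = raise (s≤s z≤n) (apply₀ (at₁ schema-¬⊤ ⊤ᶠ h) h h)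
  ¬tr⇒dual (atom true a)  h = raise (s≤s z≤n) (id⇒ {¬ᶠ fv (inj₁ a)} h)
  ¬tr⇒dual (atom false a) h = raise (s≤s z≤n) (apply₀ (at₁ schema-¬¬-elim (fv (inj₁ a)) h) h h)
  ¬tr⇒dual (var true A)   h = raise (s≤s z≤n) (id⇒ {¬ᶠ fv (inj₂ A)} h)
  ¬tr⇒dual (var false A)  h = raise (s≤s z≤n) (apply₀ (at₁ schema-¬¬-elim (fv (inj₂ A)) h) h h)
  ¬tr⇒dual (α ∨ β) h = raise (≤-reflexive (de-morgan-cost₁ (nodes α) (nodes β)))
    (apply₀ (at₂ schema-¬∨ (tr α) (tr β) (fits α (left≤ h)) (fits β (right≤ h))) (fits (α ∨ β) h) (fits (α ∨ β) h)
     ⨾ mono∧ (¬tr⇒dual α (left≤ h)) (¬tr⇒dual β (right≤ h)) (fits (α ∨ β) h) (fits-dual (α ∨ β) h))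
  ¬tr⇒dual (α ∧ β) h = raise (≤-reflexive (de-morgan-cost₁ (nodes α) (nodes β)))
    (apply₀ (at₂ schema-¬∧ (tr α) (tr β) (fits α (left≤ h)) (fits β (right≤ h))) (fits (α ∧ β) h) (fits (α ∧ β) h)
     ⨾ mono∨ (¬tr⇒dual α (left≤ h)) (¬tr⇒dual β (right≤ h)) (fits (α ∧ β) h) (fits-dual (α ∧ β) h))

  dual⇒¬tr : ∀ α → size α ≤ M → Imp (nodes α * 5) (tr (dual α)) (¬ᶠ tr α)
  dual⇒¬tr 𝕗              h = raise (s≤s z≤n) (apply₀ (at₁ schema-¬⊥ ⊤ᶠ h) h h)
  dual⇒¬tr 𝕥              h = raise (s≤s z≤n) (⊥⇒ {¬ᶠ ⊤ᶠ} h)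
  dual⇒¬tr (atom true a)  h = raise (s≤s z≤n) (id⇒ {¬ᶠ fv (inj₁ a)} h)
  dual⇒¬tr (atom false a) h = raise (s≤s z≤n) (apply₀ (at₁ schema-¬¬-intro (fv (inj₁ a)) h) h h)
  dual⇒¬tr (var true A)   h = raise (s≤s z≤n) (id⇒ {¬ᶠ fv (inj₂ A)} h)
  dual⇒¬tr (var false A)  h = raise (s≤s z≤n) (apply₀ (at₁ schema-¬¬-intro (fv (inj₂ A)) h) h h)
  dual⇒¬tr (α ∨ β) h = raise (≤-reflexive (de-morgan-cost₂ (nodes α) (nodes β)))
    (mono∧ (dual⇒¬tr α (left≤ h)) (dual⇒¬tr β (right≤ h)) (fits-dual (α ∨ β) h) (fits (α ∨ β) h)
     ⨾ apply₀ (at₂ schema-∧¬ (tr α) (tr β) (fits α (left≤ h)) (fits β (right≤ h))) (fits (α ∨ β) h) (fits (α ∨ β) h))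
  dual⇒¬tr (α ∧ β) h = raise (≤-reflexive (de-morgan-cost₂ (nodes α) (nodes β)))
    (mono∨ (dual⇒¬tr α (left≤ h)) (dual⇒¬tr β (right≤ h)) (fits-dual (α ∧ β) h) (fits (α ∧ β) h)
     ⨾ apply₀ (at₂ schema-∨¬ (tr α) (tr β) (fits α (left≤ h)) (fits β (right≤ h))) (fits (α ∧ β) h) (fits (α ∧ β) h))

  ⊑-sound : ∀ {x y} → x ⊑ y → size x ≤ M → size y ≤ M → Imp (nodes x * nodes y) (tr x) (tr y)
  ⊑-sound {y = y} ⊥⊑ hx hy = raise (≤-trans (nodes-pos y) (m≤m+n (nodes y) 0)) (⊥⇒ (fits y hy))
  ⊑-sound {x = x} ⊑⊤ hx hy = raise (≤-trans (nodes-pos x) (m≤m*n (nodes x) 1)) (⇒⊤ (fits x hx))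
  ⊑-sound {x = x} atom⊑ hx hy = id⇒ (fits x hx)
  ⊑-sound {x = x} var⊑ hx hy = id⇒ (fits x hx)
  ⊑-sound {α ∨ β} {y} (∨⊑ d₁ d₂) hx hy =
    raise (split-costˡ (nodes α) (nodes β) (nodes y) (nodes-pos y))
      (∨-elim (⊑-sound d₁ (left≤ hx) hy) (⊑-sound d₂ (right≤ hx) hy) (fits (α ∨ β) hx))
  ⊑-sound {x} {α ∧ β} (⊑∧ d₁ d₂) hx hy =
    raise (split-costʳ (nodes α) (nodes β) (nodes x) (nodes-pos x))
      (∧-intro (⊑-sound d₁ hx (left≤ hy)) (⊑-sound d₂ hx (right≤ hy)) (fits (α ∧ β) hy))
  ⊑-sound {x} {α ∨ β} (⊑∨ˡ d) hx hy =
    raise (proj₁ (shrink-costʳ (nodes α) (nodes β) (nodes x) (nodes-pos x)))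
      (∨-introˡ (⊑-sound d hx (left≤ hy)) (fits (α ∨ β) hy))
  ⊑-sound {x} {α ∨ β} (⊑∨ʳ d) hx hy =
    raise (proj₂ (shrink-costʳ (nodes α) (nodes β) (nodes x) (nodes-pos x)))
      (∨-introʳ (⊑-sound d hx (right≤ hy)) (fits (α ∨ β) hy))
  ⊑-sound {α ∧ β} {y} (∧ˡ⊑ d) hx hy =
    raise (proj₁ (shrink-costˡ (nodes α) (nodes β) (nodes y) (nodes-pos y)))
      (∧-elimˡ (⊑-sound d (left≤ hx) hy) (fits (α ∧ β) hx))
  ⊑-sound {α ∧ β} {y} (∧ʳ⊑ d) hx hy =
    raise (proj₂ (shrink-costˡ (nodes α) (nodes β) (nodes y) (nodes-pos y)))
      (∧-elimʳ (⊑-sound d (right≤ hx) hy) (fits (α ∧ β) hx))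

  -- The Frege substitution instance implies the translated CoS instance:
  -- they differ only by De Morgan laws below negated variables.
  subst-correction : ∀ γ σ → size (γ [ σ ]) ≤ M →
                     Imp (nodes (γ [ σ ]) * 5) (tr γ [ σᶠ σ ]ᶠ) (tr (γ [ σ ]))
  subst-correction 𝕗              σ h = raise (s≤s z≤n) (id⇒ {⊥ᶠ} h)
  subst-correction 𝕥              σ h = raise (s≤s z≤n) (id⇒ {⊤ᶠ} h)
  subst-correction (atom true a)  σ h = raise (s≤s z≤n) (id⇒ {fv (inj₁ a)} h)
  subst-correction (atom false a) σ h = raise (s≤s z≤n) (id⇒ {¬ᶠ fv (inj₁ a)} h)
  subst-correction (var true A)   σ h =
    raise (≤-trans (nodes-pos (σ A)) (m≤m*n (nodes (σ A)) 5)) (id⇒ (fits (σ A) h))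
  subst-correction (var false A)  σ h =
    subst (λ n → Imp (n * 5) (¬ᶠ tr (σ A)) (tr (dual (σ A)))) (sym (nodes-dual (σ A)))
          (¬tr⇒dual (σ A) (subst (_≤ M) (size-dual (σ A)) h))
  subst-correction (γ ∨ δ) σ h =
    raise (≤-trans (m≤n+m _ 2) (≤-reflexive (mono-cost (nodes (γ [ σ ])) (nodes (δ [ σ ])))))
      (mono∨ (subst-correction γ σ (left≤ h)) (subst-correction δ σ (right≤ h))
             (subst (_≤ M) (sym (fsize-tr-subst (γ ∨ δ) σ)) h) (fits ((γ ∨ δ) [ σ ]) h))
  subst-correction (γ ∧ δ) σ h =
    raise (≤-trans (m≤n+m _ 2) (≤-reflexive (mono-cost (nodes (γ [ σ ])) (nodes (δ [ σ ])))))
      (mono∧ (subst-correction γ σ (left≤ h)) (subst-correction δ σ (right≤ h))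
             (subst (_≤ M) (sym (fsize-tr-subst (γ ∧ δ) σ)) h) (fits ((γ ∧ δ) [ σ ]) h))

  rule-sound : ∀ {L R} → SKSgRule L R → ∀ ρ σ →
               size (rename L ρ [ σ ]) ≤ M → size (rename R ρ [ σ ]) ≤ M →
               Imp (6 + 10 * M) (tr (rename L ρ [ σ ])) (tr (rename R ρ [ σ ]))
  rule-sound ai↓ ρ σ hL hR =
    raise (+-monoʳ-≤ 6 (five-nodes (σ 0) (left≤ hR)))
      (apply₀ (at₁ schema-excluded-middle (tr (σ 0)) (fits (σ 0) (left≤ hR))) hL (fits-with-negation (σ 0) hR)
       ⨾ mono∨ (id⇒ (fits (σ 0) (left≤ hR))) (¬tr⇒dual (σ 0) (left≤ hR))
               (fits-with-negation (σ 0) hR) (fits (σ 0 ∨ dual (σ 0)) hR))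
  rule-sound ai↑ ρ σ hL hR =
    raise (≤-trans (≤-reflexive (cong (5 +_) (+-comm (nodes (σ 0) * 5) 1)))
                   (+-monoʳ-≤ 6 (five-nodes (σ 0) (left≤ hL))))
      (mono∧ (id⇒ (fits (σ 0) (left≤ hL))) (dual⇒¬tr (σ 0) (left≤ hL))
             (fits (σ 0 ∧ dual (σ 0)) hL) (fits-with-negation (σ 0) hL)
       ⨾ apply₀ (at₁ schema-noncontradiction (tr (σ 0)) (fits (σ 0) (left≤ hL))) (fits-with-negation (σ 0) hL) hR)
  rule-sound aw↓ ρ σ hL hR = raise (s≤s z≤n) (⊥⇒ (fits (σ 0) hR))
  rule-sound aw↑ ρ σ hL hR = raise (s≤s z≤n) (⇒⊤ (fits (σ 0) hL))
  rule-sound ac↓ ρ σ hL hR =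
    raise (s≤s z≤n)
      (apply₀ (at₁ schema-contract (tr (σ 0)) (fits (σ 0) hR)) (fits (σ 0 ∨ σ 0) hL) (fits (σ 0) hR))
  rule-sound ac↑ ρ σ hL hR =
    raise (s≤s z≤n)
      (apply₀ (at₁ schema-cocontract (tr (σ 0)) (fits (σ 0) hL)) (fits (σ 0) hL) (fits (σ 0 ∧ σ 0) hR))
  rule-sound s ρ σ hL hR =
    raise (s≤s z≤n)
      (apply₀ (at schema-switch (tr (σ 0)) (tr (σ 1)) (tr (σ 2))
                  (fits (σ 0) (left≤ hL)) (fits (σ 1) (left≤ hBC)) (fits (σ 2) (right≤ {size (σ 1)} hBC)))
              (fits (σ 0 ∧ (σ 1 ∨ σ 2)) hL) (fits ((σ 0 ∧ σ 1) ∨ σ 2) hR))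
    where
    hBC : size (σ 1) + size (σ 2) ≤ M
    hBC = right≤ {size (σ 0)} hL

  lift : ∀ {u a b} ξ → size (ξ ⟪ a ⟫) ≤ M → size (ξ ⟪ b ⟫) ≤ M →
         Imp u (tr a) (tr b) → Imp (depth ξ * 4 + u) (tr (ξ ⟪ a ⟫)) (tr (ξ ⟪ b ⟫))
  lift □ ha hb p = p
  lift {a = a} {b} (ξ ∨ₗ β) ha hb p =
    raise (≤-reflexive (cong (2 +_) (+-comm (depth ξ * 4 + _) 2)))
      (mono∨ (lift ξ (left≤ ha) (left≤ hb) p) (id⇒ (fits β (right≤ ha))) (fits (ξ ⟪ a ⟫ ∨ β) ha) (fits (ξ ⟪ b ⟫ ∨ β) hb))
  lift {a = a} {b} (α ∨ᵣ ξ) ha hb p =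
    mono∨ (id⇒ (fits α (left≤ ha))) (lift ξ (right≤ ha) (right≤ hb) p) (fits (α ∨ ξ ⟪ a ⟫) ha) (fits (α ∨ ξ ⟪ b ⟫) hb)
  lift {a = a} {b} (ξ ∧ₗ β) ha hb p =
    raise (≤-reflexive (cong (2 +_) (+-comm (depth ξ * 4 + _) 2)))
      (mono∧ (lift ξ (left≤ ha) (left≤ hb) p) (id⇒ (fits β (right≤ ha))) (fits (ξ ⟪ a ⟫ ∧ β) ha) (fits (ξ ⟪ b ⟫ ∧ β) hb))
  lift {a = a} {b} (α ∧ᵣ ξ) ha hb p =
    mono∧ (id⇒ (fits α (left≤ ha))) (lift ξ (right≤ ha) (right≤ hb) p) (fits (α ∧ ξ ⟪ a ⟫) ha) (fits (α ∧ ξ ⟪ b ⟫) hb)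

  -- Each step costs at most a substitution line, an implication of at most
  -- budget units, and one modus ponens.
  budget stepLength : ℕ
  budget     = 64 * (M * M)
  stepLength = 2 + budget * κ

  conclude : ∀ {u L X Y} → Imp u X Y → u ≤ budget → Proof W (suc L) X → Proof W (stepLength + L) Y
  conclude {u} {L} i u≤ p = lengthen cost (derivation i ·ᵖ p)
    where
    cost : suc (u * κ + suc L) ≤ stepLength + L
    cost = s≤s (≤-trans (≤-reflexive (+-suc (u * κ) L)) (s≤s (+-monoˡ-≤ L (*-monoˡ-≤ κ u≤))))

  simulate-equality : ∀ {α β L} → α ≈ β → size α ≤ M → size β ≤ M →
                      Proof W L (tr α) → Proof W (stepLength + L) (tr β)
  simulate-equality {α} {β} e hα hβ p =
    conclude (⊑-sound (proj₁ (≈⇒⊑ e)) hα hβ) (budget-square {M} (nodes-fit α hα) (nodes-fit β hβ))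
             (lengthen (n≤1+n _) p)

  simulate-step : ∀ {α β L} → sSKSgStep α β → size α ≤ M → size β ≤ M →
                  Proof W L (tr α) → Proof W (stepLength + L) (tr β)
  simulate-step (sks (step {γ} r ρ σ ξ)) hα hβ p =
    conclude (lift ξ hα hβ (rule-sound r ρ σ (≤-trans (size-ctx ξ _) hα) (≤-trans (size-ctx ξ _) hβ)))
             (≤-trans (budget-rule {M} (≤-trans (depth≤nodes ξ (rename γ ρ [ σ ])) (nodes-fit _ hα)) 1≤M)
                      (budget-linear {M} {24} (m≤m+n 24 40) 1≤M))
             (lengthen (n≤1+n _) p)
    where
    1≤M : 1 ≤ M
    1≤M = ≤-trans (size-pos (ξ ⟪ rename γ ρ [ σ ] ⟫)) hα
  simulate-step {γ} (sub σ) hγ hγσ p =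
    conclude (subst-correction γ σ hγσ)
             (≤-trans (five-nodes (γ [ σ ]) hγσ) (budget-linear {M} {10} (m≤m+n 10 54) (≤-trans (size-pos γ) hγ)))
             (substitute (σᶠ σ) width p)
    where
    width : fsize (tr γ [ σᶠ σ ]ᶠ) ≤ W
    width = ≤-trans (≤-reflexive (fsize-tr-subst γ σ)) (≤-trans hγσ (m≤n*m M schemaWidth))

  mutual
    simulateE : ∀ {α γ L} (d : ChainE sSKSgStep α γ) → sizeE sSKSgStep d ≤ M →
                Proof W L (tr α) → Proof W (sizeE sSKSgStep d * stepLength + L) (tr γ)
    simulateE {L = L} (stopE α) h p = lengthen (m≤n+m L (size α * stepLength)) p
    simulateE {α} {L = L} (eqE e d) h p =
      lengthen (chain-cost (size α) (sizeR sSKSgStep d) stepLength L (size-pos α))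
        (simulateR d (right≤ h) (simulate-equality e (left≤ h) (≤-trans (first-sizeR d) (right≤ h)) p))

    simulateR : ∀ {α γ L} (d : ChainR sSKSgStep α γ) → sizeR sSKSgStep d ≤ M →
                Proof W L (tr α) → Proof W (sizeR sSKSgStep d * stepLength + L) (tr γ)
    simulateR {L = L} (stopR α) h p = lengthen (m≤n+m L (size α * stepLength)) p
    simulateR {α} {L = L} (rlR st d) h p =
      lengthen (chain-cost (size α) (sizeE sSKSgStep d) stepLength L (size-pos α))
        (simulateE d (right≤ h) (simulate-step st (left≤ h) (≤-trans (first-sizeE d) (right≤ h)) p))

  simulate : ∀ {α γ L} (d : Derivation sSKSgStep α γ) → derivationSize sSKSgStep d ≤ M →
             Proof W L (tr α) → Proof W (derivationSize sSKSgStep d * stepLength + L) (tr γ)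
  simulate (inj₁ d) = simulateE d
  simulate (inj₂ d) = simulateR d

simulate-proof : ∀ {φ} (p : sSKSgProof φ) →
                 Proof (schemaWidth * sSKSgSize p) (sSKSgSize p * Simulation.stepLength (sSKSgSize p) + schemaLength) (tr φ)
simulate-proof p = Simulation.simulate (sSKSgSize p) p ≤-refl (at₁ schema-⊤ ⊤ᶠ (derivationSize-pos p))

lengthConstant : ℕ
lengthConstant = 2 + 64 * κ + schemaLength

-- n steps of O(n²) lines each after a constant number of lines: O(n⁴) lines.
length-bound : ∀ n → 1 ≤ n → n * Simulation.stepLength n + schemaLength ≤ lengthConstant * n ^ 4
length-bound n 1≤n = begin
  n * (2 + 64 * (n * n) * κ) + schemaLength
    ≡⟨ expand n κ schemaLength ⟩
  2 * n ^ 1 + 64 * κ * n ^ 3 + schemaLength * n ^ 0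
    ≤⟨ +-mono-≤ (+-mono-≤ (*-monoʳ-≤ 2 (power (s≤s z≤n))) (*-monoʳ-≤ (64 * κ) (power (s≤s (s≤s (s≤s z≤n))))))
                (*-monoʳ-≤ schemaLength (power z≤n)) ⟩
  2 * n ^ 4 + 64 * κ * n ^ 4 + schemaLength * n ^ 4
    ≡⟨ collect n κ schemaLength ⟩
  lengthConstant * n ^ 4 ∎
  where
  open ≤-Reasoning
  power : ∀ {i} → i ≤ 4 → n ^ i ≤ n ^ 4
  power = ^-monoʳ-≤ n {{>-nonZero 1≤n}}
  -- The ring solver does not handle _^_, so the powers are written out.
  expand : ∀ n k c → n * (2 + 64 * (n * n) * k) + c ≡ 2 * (n * 1) + 64 * k * (n * (n * (n * 1))) + c * 1
  expand = solve-∀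
  collect : ∀ n k c → let n⁴ = n * (n * (n * (n * 1))) in 2 * n⁴ + 64 * k * n⁴ + c * n⁴ ≡ (2 + 64 * k + c) * n⁴
  collect = solve-∀

size-bound : ∀ n L → L ≤ lengthConstant * n ^ 4 → L * (schemaWidth * n) ≤ lengthConstant * schemaWidth * n ^ 5
size-bound n L L≤ = ≤-trans (*-monoˡ-≤ (schemaWidth * n) L≤) (≤-reflexive (regroup lengthConstant schemaWidth n))
  where
  regroup : ∀ c w n → let n⁴ = n * (n * (n * (n * 1))) in c * n⁴ * (w * n) ≡ c * w * (n * n⁴)
  regroup = solve-∀

polynomial-simulation : ∀ {φ} (p : sSKSgProof φ) → Σ (sFregeProof (tr φ)) λ q →
  (sFregeLength q ≤ lengthConstant * schemaWidth * sSKSgSize p ^ 4) ×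
  (sFregeSize q ≤ lengthConstant * schemaWidth * sSKSgSize p ^ 5)
polynomial-simulation p with linearise-bounded (simulate-proof p)
... | q , length≤ , size≤ =
  q , ≤-trans length≤ (≤-trans lines≤ (*-monoˡ-≤ (n ^ 4) (m≤m*n lengthConstant schemaWidth)))
    , ≤-trans size≤ (size-bound n _ lines≤)
  where
  n : ℕ
  n = sSKSgSize p
  lines≤ : n * Simulation.stepLength n + schemaLength ≤ lengthConstant * n ^ 4
  lines≤ = length-bound n (derivationSize-pos p)

theorem5p13 : Σ ℕ λ c → ∀ {φ : Fm} (p : sSKSgProof φ) →
    Σ (sFregeProof (tr φ)) λ q →
      (sFregeLength q ≤ c * sSKSgSize p ^ 4) × (sFregeSize q ≤ c * sSKSgSize p ^ 5)
theorem5p13 = lengthConstant * schemaWidth , polynomial-simulation
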